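{- Let $H=(X,\mathcal{B})$ be a segregated $k$-uniform hypergraph with $|X|=n$, $|\mathcal{B}|=j$ and exactly $r$ isolated blocks. Then \[\mathfrak{E}(X)=jk+rk-2n,\] where $\mathfrak{E}(X)=\sum_{i>2}(i-2)d_i$ and $d_i$ is the number of vertices of degree $i$.
   Context: The degree of a vertex is the number of blocks containing it. A block is isolated if it is disjoint from every other block; the hypergraph is segregated if no vertex has degree $0$ and every vertex of degree $1$ lies in an isolated block. -}

module Defs where

open import Data.Nat using (ℕ; zero; suc; _+_; _*_; _∸_)
open import Data.Nat.Properties using (_≟_)
open import Data.Fin using (Fin; zero; suc; toℕ)
open import Data.Fin.Subset using (Subset; _∈_; _∩_; ∣_∣; Empty)
open import Data.Vec using (lookup)
open import Data.Bool using (Bool; true; false)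
open import Data.Product using (Σ; _×_; ∃)
open import Relation.Nullary using (¬_; ⌊_⌋)
open import Relation.Binary.PropositionalEquality using (_≡_; _≢_)

ΣF : {m : ℕ} → (Fin m → ℕ) → ℕ
ΣF {zero}  f = 0
ΣF {suc m} f = f zero + ΣF (λ i → f (suc i))

countF : {m : ℕ} → (Fin m → Bool) → ℕ
countF p = ΣF (λ i → if′ (p i))
  where
  if′ : Bool → ℕ
  if′ true  = 1
  if′ false = 0

Blocks : ℕ → ℕ → Set
Blocks n j = Fin j → Subset n

degree : {n j : ℕ} → Blocks n j → Fin n → ℕ
degree B v = countF (λ b → lookup (B b) v)

Uniform : {n j : ℕ} → ℕ → Blocks n j → Set
Uniform k B = ∀ b → ∣ B b ∣ ≡ k

Isolated : {n j : ℕ} → Blocks n j → Fin j → Set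
Isolated B b = ∀ b′ → b′ ≢ b → Empty (B b ∩ B b′)

Segregated : {n j : ℕ} → Blocks n j → Set
Segregated B =
  (∀ v → degree B v ≢ 0) ×
  (∀ v → degree B v ≡ 1 → ∃ λ b → (v ∈ B b) × Isolated B b)

NumIsolated : {n j : ℕ} → Blocks n j → ℕ → Set
NumIsolated {n} {j} B r =
  Σ (Subset j) λ S → (∣ S ∣ ≡ r) × (∀ b → (b ∈ S → Isolated B b) × (Isolated B b → b ∈ S))

d : {n j : ℕ} → Blocks n j → ℕ → ℕ
d B i = countF (λ v → ⌊ degree B v ≟ i ⌋)

-- 𝔈(X) = Σ_{i>2} (i-2) d_i. Degrees are at most j, so i ranges over 0..j;
-- for i ≤ 2 the factor i ∸ 2 is 0, so those terms vanish.
𝔈 : {n j : ℕ} → Blocks n j → ℕ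
𝔈 {n} {j} B = ΣF {suc j} (λ i → (toℕ i ∸ 2) * d B (toℕ i))

-- Count incidences between vertices and blocks twice. Summing degrees gives jk. Every vertex
-- satisfies (deg v ∸ 2) + 2 = deg v + [deg v = 1], because no degree is 0; summing over the n
-- vertices gives 𝔈 + 2n = jk + d₁. In a segregated hypergraph the vertices of degree 1 are
-- exactly the vertices of the isolated blocks, which are pairwise disjoint, so d₁ = rk.
module Submission where

open import Defs
open import Data.Nat using (ℕ; _*_)
open import Relation.Binary.PropositionalEquality using (_≡_)

import Data.Nat as ℕ
open import Data.Nat.Properties using (+-*-semiring; m+n∸n≡m; m≤n+m)
open import Data.Fin using (Fin; zero; suc; toℕ; fromℕ<; punchIn)
open import Data.Fin.Properties using (punchInᵢ≢i; toℕ-fromℕ<; toℕ-injective)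
open import Data.Fin.Subset using (Subset; _∈_; ∣_∣)
open import Data.Fin.Subset.Properties using (x∈p∩q⁺)
open import Data.Vec using ([]; _∷_; lookup)
open import Data.Vec.Properties using ([]=⇒lookup; lookup⇒[]=)
open import Data.Bool using (Bool; true; false)
open import Data.Product using (_×_; _,_; ∃; proj₁; proj₂)
open import Data.Empty using (⊥-elim)
open import Function using (_∘_)
open import Relation.Nullary using (⌊_⌋; yes; no)
open import Relation.Binary.PropositionalEquality
  using (_≢_; refl; sym; trans; cong; cong₂; subst; module ≡-Reasoning)
open import Algebra.Properties.Semiring.Sum +-*-semiring
  using (sum; sum-cong-≗; sum-remove; sum-replicate-zero; ∑-comm; ∑-distrib-+; *-distribˡ-sum; *-distribʳ-sum)

open ≡-Reasoning

𝟙 : Bool → ℕ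
𝟙 true  = 1
𝟙 false = 0

module FinSum where

  open Data.Nat using (zero; suc; _+_; _≤_; z≤n; s≤s; _≟_)
  open Data.Nat.Properties using (*-identityʳ; *-zeroʳ; +-identityʳ; m≤n⇒m≤1+n)

  ΣF≡sum : {m : ℕ} (f : Fin m → ℕ) → ΣF f ≡ sum f
  ΣF≡sum {zero}  f = refl
  ΣF≡sum {suc m} f = cong (f zero +_) (ΣF≡sum (f ∘ suc))

  countF≡sum : {m : ℕ} (p : Fin m → Bool) → countF p ≡ sum (𝟙 ∘ p)
  countF≡sum {zero}  p = refl
  countF≡sum {suc m} p with p zero
  ... | true  = cong suc (countF≡sum (p ∘ suc))
  ... | false = countF≡sum (p ∘ suc)

  ∣p∣≡sum : {m : ℕ} (p : Subset m) → ∣ p ∣ ≡ sum (𝟙 ∘ lookup p)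
  ∣p∣≡sum []          = refl
  ∣p∣≡sum (true  ∷ p) = cong suc (∣p∣≡sum p)
  ∣p∣≡sum (false ∷ p) = ∣p∣≡sum p

  sum-𝟙≤ : {m : ℕ} (p : Fin m → Bool) → sum (𝟙 ∘ p) ≤ m
  sum-𝟙≤ {zero}  p = z≤n
  sum-𝟙≤ {suc m} p with p zero
  ... | true  = s≤s (sum-𝟙≤ (p ∘ suc))
  ... | false = m≤n⇒m≤1+n (sum-𝟙≤ (p ∘ suc))

  sum-const : {m : ℕ} (c : ℕ) → sum {m} (λ _ → c) ≡ m * c
  sum-const {zero}  c = refl
  sum-const {suc m} c = cong (c +_) (sum-const {m} c)

  sum-single : {m : ℕ} (f : Fin m → ℕ) (i₀ : Fin m) → (∀ i → i ≢ i₀ → f i ≡ 0) → sum f ≡ f i₀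
  sum-single {zero}  f ()
  sum-single {suc m} f i₀ f≡0 = begin
    sum f                                  ≡⟨ sum-remove {i = i₀} f ⟩
    f i₀ + sum (λ k → f (punchIn i₀ k))     ≡⟨ cong (f i₀ +_) (sum-cong-≗ (λ k → f≡0 _ (punchInᵢ≢i i₀ k))) ⟩
    f i₀ + sum {m} (λ _ → 0)                ≡⟨ cong (f i₀ +_) (sum-replicate-zero m) ⟩
    f i₀ + 0                               ≡⟨ +-identityʳ (f i₀) ⟩
    f i₀                                   ∎

  -- Grouping the terms of Σᵥ f (g v) by the value i = g v.
  sum-by-value : {n m : ℕ} (f : ℕ → ℕ) (g : Fin n → ℕ) → (∀ v → g v ≤ m) →
                 sum {suc m} (λ i → f (toℕ i) * countF (λ v → ⌊ g v ≟ toℕ i ⌋)) ≡ sum (f ∘ g)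
  sum-by-value {n} {m} f g g≤m = begin
    sum {suc m} (λ i → f (toℕ i) * countF (λ v → ⌊ g v ≟ toℕ i ⌋))
      ≡⟨ sum-cong-≗ {suc m} (λ i → cong (f (toℕ i) *_) (countF≡sum {n} (λ v → ⌊ g v ≟ toℕ i ⌋))) ⟩
    sum {suc m} (λ i → f (toℕ i) * sum (λ v → 𝟙 ⌊ g v ≟ toℕ i ⌋))
      ≡⟨ sum-cong-≗ {suc m} (λ i → *-distribˡ-sum {n} (f (toℕ i)) (λ v → 𝟙 ⌊ g v ≟ toℕ i ⌋)) ⟩
    sum {suc m} (λ i → sum (λ v → f (toℕ i) * 𝟙 ⌊ g v ≟ toℕ i ⌋))
      ≡⟨ ∑-comm {suc m} {n} (λ i v → f (toℕ i) * 𝟙 ⌊ g v ≟ toℕ i ⌋) ⟩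
    sum (λ v → sum {suc m} (λ i → f (toℕ i) * 𝟙 ⌊ g v ≟ toℕ i ⌋))
      ≡⟨ sum-cong-≗ (λ v → sum-at-value (g v) (g≤m v)) ⟩
    sum (f ∘ g) ∎
    where
    sum-at-value : ∀ x → x ≤ m → sum {suc m} (λ i → f (toℕ i) * 𝟙 ⌊ x ≟ toℕ i ⌋) ≡ f x
    sum-at-value x x≤m = trans (sum-single _ x̂ off-x) at-x
      where
      x̂ : Fin (suc m)
      x̂ = fromℕ< (s≤s x≤m)
      x̂≡x : toℕ x̂ ≡ x
      x̂≡x = toℕ-fromℕ< (s≤s x≤m)
      at-x : f (toℕ x̂) * 𝟙 ⌊ x ≟ toℕ x̂ ⌋ ≡ f x
      at-x rewrite x̂≡x with x ≟ x
      ... | yes _ = *-identityʳ (f x)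
      ... | no x≢x = ⊥-elim (x≢x refl)
      off-x : ∀ i → i ≢ x̂ → f (toℕ i) * 𝟙 ⌊ x ≟ toℕ i ⌋ ≡ 0
      off-x i i≢x̂ with x ≟ toℕ i
      ... | yes x≡i = ⊥-elim (i≢x̂ (toℕ-injective (trans (sym x≡i) (sym x̂≡x))))
      ... | no _    = *-zeroʳ (f (toℕ i))

open FinSum

module Incidence {n j : ℕ} (B : Blocks n j) where

  open Data.Nat using (zero; suc; _+_; _∸_; _≤_; _≟_)
  open Data.Nat.Properties using (*-comm; +-comm; +-identityʳ; *-zeroʳ)

  degree≡sum : ∀ v → degree B v ≡ sum (λ b → 𝟙 (lookup (B b) v))
  degree≡sum v = countF≡sum (λ b → lookup (B b) v)

  sum-degree≡sum-size : sum (degree B) ≡ sum (λ b → ∣ B b ∣)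
  sum-degree≡sum-size = begin
    sum (degree B)                                ≡⟨ sum-cong-≗ degree≡sum ⟩
    sum (λ v → sum (λ b → 𝟙 (lookup (B b) v)))     ≡⟨ ∑-comm (λ v b → 𝟙 (lookup (B b) v)) ⟩
    sum (λ b → sum (λ v → 𝟙 (lookup (B b) v)))     ≡⟨ sum-cong-≗ (λ b → sym (∣p∣≡sum (B b))) ⟩
    sum (λ b → ∣ B b ∣)                            ∎

  sum-degree≡j*k : {k : ℕ} → Uniform k B → sum (degree B) ≡ j * k
  sum-degree≡j*k {k} unif = trans sum-degree≡sum-size (trans (sum-cong-≗ unif) (sum-const {j} k))

  𝔈≡sum-excess : 𝔈 B ≡ sum (λ v → degree B v ∸ 2)
  𝔈≡sum-excess = trans (ΣF≡sum {suc j} (λ i → (toℕ i ∸ 2) * d B (toℕ i)))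
                       (sum-by-value (_∸ 2) (degree B) degree≤j)
    where
    degree≤j : ∀ v → degree B v ≤ j
    degree≤j v = subst (_≤ j) (sym (degree≡sum v)) (sum-𝟙≤ (λ b → lookup (B b) v))

  𝔈+2n≡sum-degree+d₁ : (∀ v → degree B v ≢ 0) → 𝔈 B + 2 * n ≡ sum (degree B) + d B 1
  𝔈+2n≡sum-degree+d₁ deg≢0 = begin
    𝔈 B + 2 * n
      ≡⟨ cong₂ _+_ 𝔈≡sum-excess (sym sum-const-2n) ⟩
    sum (λ v → degree B v ∸ 2) + sum {n} (λ _ → 2)
      ≡⟨ sym (∑-distrib-+ (λ v → degree B v ∸ 2) (λ _ → 2)) ⟩
    sum (λ v → degree B v ∸ 2 + 2)
      ≡⟨ sum-cong-≗ (λ v → excess+2 (degree B v) (deg≢0 v)) ⟩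
    sum (λ v → degree B v + 𝟙 ⌊ degree B v ≟ 1 ⌋)
      ≡⟨ ∑-distrib-+ (degree B) (λ v → 𝟙 ⌊ degree B v ≟ 1 ⌋) ⟩
    sum (degree B) + sum (λ v → 𝟙 ⌊ degree B v ≟ 1 ⌋)
      ≡⟨ cong (sum (degree B) +_) (sym (countF≡sum (λ v → ⌊ degree B v ≟ 1 ⌋))) ⟩
    sum (degree B) + d B 1 ∎
    where
    sum-const-2n : sum {n} (λ _ → 2) ≡ 2 * n
    sum-const-2n = trans (sum-const {n} 2) (*-comm n 2)
    excess+2 : ∀ x → x ≢ 0 → x ∸ 2 + 2 ≡ x + 𝟙 ⌊ x ≟ 1 ⌋
    excess+2 zero          x≢0 = ⊥-elim (x≢0 refl)
    excess+2 (suc zero)    _   = refl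
    excess+2 (suc (suc x)) _   = trans (+-comm x 2) (sym (+-identityʳ _))

  isolated⇒∉ : ∀ {b b′ v} → Isolated B b → v ∈ B b → b′ ≢ b → lookup (B b′) v ≡ false
  isolated⇒∉ {b} {b′} {v} iso v∈b b′≢b with lookup (B b′) v in v∈b′
  ... | true  = ⊥-elim (iso b′ b′≢b (v , x∈p∩q⁺ (v∈b , lookup⇒[]= v (B b′) v∈b′)))
  ... | false = refl

  isolated⇒degree≡1 : ∀ {b v} → Isolated B b → v ∈ B b → degree B v ≡ 1
  isolated⇒degree≡1 {b} {v} iso v∈b = begin
    degree B v                          ≡⟨ degree≡sum v ⟩
    sum (λ b′ → 𝟙 (lookup (B b′) v))    ≡⟨ sum-single _ b (λ b′ b′≢b → cong 𝟙 (isolated⇒∉ iso v∈b b′≢b)) ⟩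
    𝟙 (lookup (B b) v)                  ≡⟨ cong 𝟙 ([]=⇒lookup v∈b) ⟩
    1                                   ∎

  IsolatedSet : Subset j → Set
  IsolatedSet S = ∀ b → (b ∈ S → Isolated B b) × (Isolated B b → b ∈ S)

  -- A vertex of degree 1 lies in exactly one block, which is isolated; any other vertex lies in
  -- no isolated block at all.
  𝟙[degree≡1]≡#isolated-blocks-containing : ∀ {S} → IsolatedSet S →
    (∀ v → degree B v ≡ 1 → ∃ λ b → v ∈ B b × Isolated B b) →
    ∀ v → 𝟙 ⌊ degree B v ≟ 1 ⌋ ≡ sum (λ b → 𝟙 (lookup S b) * 𝟙 (lookup (B b) v))
  𝟙[degree≡1]≡#isolated-blocks-containing {S} isoS seg v with degree B v ≟ 1
  ... | yes deg≡1 = sym (trans (sum-single _ b other-blocks) own-block)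
    where
    b = proj₁ (seg v deg≡1)
    v∈b = proj₁ (proj₂ (seg v deg≡1))
    iso = proj₂ (proj₂ (seg v deg≡1))
    own-block : 𝟙 (lookup S b) * 𝟙 (lookup (B b) v) ≡ 1
    own-block rewrite []=⇒lookup (proj₂ (isoS b) iso) | []=⇒lookup v∈b = refl
    other-blocks : ∀ b′ → b′ ≢ b → 𝟙 (lookup S b′) * 𝟙 (lookup (B b′) v) ≡ 0
    other-blocks b′ b′≢b rewrite isolated⇒∉ iso v∈b b′≢b = *-zeroʳ (𝟙 (lookup S b′))
  ... | no deg≢1 = sym (trans (sum-cong-≗ no-isolated-block) (sum-replicate-zero j))
    where
    no-isolated-block : ∀ b → 𝟙 (lookup S b) * 𝟙 (lookup (B b) v) ≡ 0
    no-isolated-block b with lookup S b in b∈S | lookup (B b) v in v∈b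
    ... | true  | true  = ⊥-elim (deg≢1 (isolated⇒degree≡1
                            (proj₁ (isoS b) (lookup⇒[]= b S b∈S)) (lookup⇒[]= v (B b) v∈b)))
    ... | true  | false = refl
    ... | false | _     = refl

  d₁≡r*k : {k r : ℕ} → Uniform k B → Segregated B → NumIsolated B r → d B 1 ≡ r * k
  d₁≡r*k {k} {r} unif (_ , seg) (S , ∣S∣≡r , isoS) = begin
    d B 1
      ≡⟨ countF≡sum (λ v → ⌊ degree B v ≟ 1 ⌋) ⟩
    sum (λ v → 𝟙 ⌊ degree B v ≟ 1 ⌋)
      ≡⟨ sum-cong-≗ (𝟙[degree≡1]≡#isolated-blocks-containing isoS seg) ⟩
    sum (λ v → sum (λ b → 𝟙 (lookup S b) * 𝟙 (lookup (B b) v)))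
      ≡⟨ ∑-comm (λ v b → 𝟙 (lookup S b) * 𝟙 (lookup (B b) v)) ⟩
    sum (λ b → sum (λ v → 𝟙 (lookup S b) * 𝟙 (lookup (B b) v)))
      ≡⟨ sum-cong-≗ (λ b → sym (*-distribˡ-sum (𝟙 (lookup S b)) (λ v → 𝟙 (lookup (B b) v)))) ⟩
    sum (λ b → 𝟙 (lookup S b) * sum (λ v → 𝟙 (lookup (B b) v)))
      ≡⟨ sum-cong-≗ (λ b → cong (𝟙 (lookup S b) *_) (trans (sym (∣p∣≡sum (B b))) (unif b))) ⟩
    sum (λ b → 𝟙 (lookup S b) * k)
      ≡⟨ sym (*-distribʳ-sum k (𝟙 ∘ lookup S)) ⟩
    sum (𝟙 ∘ lookup S) * k
      ≡⟨ cong (_* k) (trans (sym (∣p∣≡sum S)) ∣S∣≡r) ⟩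
    r * k ∎

open Incidence

-- Opened only now: its _+_ and +_ would clash with ℕ's _+_ and its sections above.
open import Data.Integer using (+_; _+_; _-_; _⊖_)
open import Data.Integer.Properties using (pos-+; ⊖-≥; [+m]-[+n]≡m⊖n)

m+n≡o⇒+m≡+o-+n : ∀ {m n o} → m ℕ.+ n ≡ o → + m ≡ + o - + n
m+n≡o⇒+m≡+o-+n {m} {n} refl = begin
  + m                ≡⟨ cong +_ (sym (m+n∸n≡m m n)) ⟩
  + (m ℕ.+ n ℕ.∸ n)  ≡⟨ sym (⊖-≥ (m≤n+m n m)) ⟩
  (m ℕ.+ n) ⊖ n      ≡⟨ sym ([+m]-[+n]≡m⊖n (m ℕ.+ n) n) ⟩
  + (m ℕ.+ n) - + n  ∎

lemma3p15 : (n j k r : ℕ) (B : Blocks n j) →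
    Uniform k B → Segregated B → NumIsolated B r →
    + 𝔈 B ≡ (+ (j * k) + + (r * k)) - + (2 * n)
lemma3p15 n j k r B unif seg iso = begin
  + 𝔈 B                                ≡⟨ m+n≡o⇒+m≡+o-+n 𝔈+2n≡jk+rk ⟩
  + (j * k ℕ.+ r * k) - + (2 * n)      ≡⟨ cong (_- + (2 * n)) (pos-+ (j * k) (r * k)) ⟩
  (+ (j * k) + + (r * k)) - + (2 * n)  ∎
  where
  𝔈+2n≡jk+rk : 𝔈 B ℕ.+ 2 * n ≡ j * k ℕ.+ r * k
  𝔈+2n≡jk+rk = begin
    𝔈 B ℕ.+ 2 * n              ≡⟨ 𝔈+2n≡sum-degree+d₁ B (proj₁ seg) ⟩
    sum (degree B) ℕ.+ d B 1   ≡⟨ cong₂ ℕ._+_ (sum-degree≡j*k B unif) (d₁≡r*k B unif seg iso) ⟩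
    j * k ℕ.+ r * k            ∎
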